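{- Let $j$ be a positive integer and define $C:\mathbb{Z}\to\mathbb{Z}$ by $C(n)=\sum_{i=0}^{j-1}\left\lceil \frac{n-i}{2j}\right\rceil$. Let $s_1,a_1,s_2,a_2$ be integers. Then $C$ formally satisfies the nested recursion $R(n)=R(n-s_1-R(n-a_1))+R(n-s_2-R(n-a_2))$, i.e. $C(n)=C(n-s_1-C(n-a_1))+C(n-s_2-C(n-a_2))$ for all $n\in\mathbb{Z}$, if and only if all of the following hold: (i) $s_1\equiv 0 \pmod j$ and $s_2\equiv 0\pmod j$; (ii) $a_1\equiv j\pmod{2j}$ and $a_2\equiv j \pmod{2j}$; (iii) $2(s_1+s_2)=a_1+a_2$.
   Context: A sequence defined on all integers formally satisfies a recursion if the recursive formula is well-defined and true on that sequence for all integers $n$. -}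

module Defs where

open import Data.Nat as ℕ using (ℕ; zero; suc; NonZero)
open import Data.Integer using (ℤ; +_; _+_; _-_; -_; _*_; _/ℕ_)

-- ceiling division of an integer by a positive natural: ⌈ x / m ⌉ = - ⌊ (- x) / m ⌋
-- (_/ℕ_ is floor division, the remainder _%ℕ_ being in [0, m))
ceilDiv : ℤ → (m : ℕ) → .{{_ : NonZero m}} → ℤ
ceilDiv x m = - ((- x) /ℕ m)

sumTo : ℕ → (ℕ → ℤ) → ℤ
sumTo zero    f = + 0
sumTo (suc k) f = sumTo k f + f k

C : (j : ℕ) → .{{_ : NonZero j}} → ℤ → ℤ
C (suc k) n = sumTo (suc k) (λ i → ceilDiv (n - + i) (2 ℕ.* suc k))

-- R formally satisfies R(n) = R(n - s₁ - R(n - a₁)) + R(n - s₂ - R(n - a₂))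
-- (functions ℤ → ℤ are total, so well-definedness is automatic)
SatisfiesRec : (ℤ → ℤ) → ℤ → ℤ → ℤ → ℤ → Set
SatisfiesRec R s₁ a₁ s₂ a₂ =
  ∀ n → R n ≡ R (n - s₁ - R (n - a₁)) + R (n - s₂ - R (n - a₂))
  where open import Relation.Binary.PropositionalEquality using (_≡_)

module Submission where

open import Defs
open import Data.Nat using (ℕ; NonZero)
open import Data.Integer using (ℤ; +_; _+_; _-_; _*_)
open import Data.Integer.Divisibility using (_∣_)
open import Data.Product using (_×_)
open import Function.Bundles using (_⇔_)
open import Relation.Binary.PropositionalEquality using (_≡_)

open import Data.Empty using (⊥-elim)
open import Data.Integer using (-_; _/ℕ_; _%ℕ_; _≤_; _<_; +<+)
open import Data.Integer.DivMod using (a≡a%ℕn+[a/ℕn]*n; n%ℕd<d; [n/ℕd]*d≤n; n<s[n/ℕd]*d)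
import Data.Integer.Divisibility.Signed as Signed
import Data.Integer.Properties as ℤP
open import Data.Integer.Tactic.RingSolver using (solve-∀; solve)
open import Data.List using (_∷_; [])
open import Data.Nat as ℕ using (zero; suc; _⊓_; _∸_)
import Data.Nat.Properties as ℕP
open import Data.Product using (Σ; _,_; proj₁; proj₂)
open import Function.Bundles using (mk⇔; Equivalence)
open import Relation.Binary.PropositionalEquality
  using (refl; sym; trans; cong; cong₂; subst; module ≡-Reasoning)
open import Relation.Nullary using (yes; no)

open import Algebra.Properties.AbelianGroup ℤP.+-0-abelianGroup using (∙-cancelˡ; ∙-cancelʳ)

open ≡-Reasoning

-- Writing n = r + 2jq with 0 ≤ r < 2j, one computes C(n) = jq + min(r, j): C rises with
-- slope 1 on [2jq, 2jq + j] and is constant on [2jq + j, 2jq + 2j].  Hence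
-- C(n + 2j) = C(n) + j and C(n) + C(n - j) = n.  If a + j = 2jβ, these two laws give
-- n - s - C(n - a) = C(n) + c with c = a - s - βj, and C(x + c₁) + C(x + c₂) = x whenever
-- j ∣ c₁ and c₁ + c₂ + j = 0; the latter is equivalent to (iii) and j ∣ cᵢ to j ∣ sᵢ.
-- Conversely, adding the recursion at n and at n + 2j and using the same two laws shows
-- that 2C(n) - C(n - B₁) - C(n - B₂) is constant, where Bᵢ is the residue of aᵢ + j
-- modulo 2j.  As C(2j - B) ≥ C(j - B) for 0 ≤ B < 2j, with equality only at B = 0,
-- comparing n = j with n = 2j gives B₁ = B₂ = 0, which is (ii), and then
-- c₁ + c₂ + j = 0, which is (iii).  Finally C is onto, and the recursion at a point
-- where C takes the value c₁ gives C(2c₁) = c₁, which forces j ∣ c₁ and hence (i).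

pos-∸ : ∀ {m n} → n ℕ.≤ m → + (m ∸ n) ≡ + m - + n
pos-∸ {m} {n} n≤m = trans (sym (ℤP.⊖-≥ n≤m)) (sym (ℤP.[+m]-[+n]≡m⊖n m n))

[ρ+ρ]⊓m≡ρ⇒ρ≡0 : ∀ {ρ m} → ρ ℕ.< m → (ρ ℕ.+ ρ) ⊓ m ≡ ρ → ρ ≡ 0
[ρ+ρ]⊓m≡ρ⇒ρ≡0 {ρ} {m} ρ<m fixed with ρ ℕ.+ ρ ℕ.≤? m
... | yes 2ρ≤m = ℕP.+-cancelˡ-≡ ρ ρ 0
                   (trans (trans (sym (ℕP.m≤n⇒m⊓n≡m 2ρ≤m)) fixed) (sym (ℕP.+-identityʳ ρ)))
... | no 2ρ≰m  = ⊥-elim (ℕP.<-irrefl (trans (sym fixed) (ℕP.m≥n⇒m⊓n≡n (ℕP.<⇒≤ (ℕP.≰⇒> 2ρ≰m))))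
                                     ρ<m)

%ℕ≡0⇒≡/ℕ* : ∀ x m .{{_ : NonZero m}} → x %ℕ m ≡ 0 → x ≡ x /ℕ m * + m
%ℕ≡0⇒≡/ℕ* x m r≡0 = begin
  x                          ≡⟨ a≡a%ℕn+[a/ℕn]*n x m ⟩
  + (x %ℕ m) + x /ℕ m * + m  ≡⟨ cong (λ r → + r + x /ℕ m * + m) r≡0 ⟩
  + 0 + x /ℕ m * + m         ≡⟨ ℤP.+-identityˡ _ ⟩
  x /ℕ m * + m               ∎

multiples-between : ∀ m .{{_ : NonZero m}} {a b x : ℤ} →
                    a * + m ≤ x → x < (+ 1 + b) * + m → a ≤ b
multiples-between m am≤x x<[1+b]m = ℤP.≮⇒≥ λ b<a →
  ℤP.<-irrefl refl (ℤP.<-≤-trans x<[1+b]m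
    (ℤP.≤-trans (ℤP.*-monoʳ-≤-nonNeg (+ m) (ℤP.i<j⇒suc[i]≤j b<a)) am≤x))

/ℕ-unique : ∀ m .{{_ : NonZero m}} (t : ℕ) (q : ℤ) → t ℕ.< m → (+ t + q * + m) /ℕ m ≡ q
/ℕ-unique m t q t<m = ℤP.≤-antisym
  (multiples-between m ([n/ℕd]*d≤n x m) x<[1+q]m)
  (multiples-between m (ℤP.i≤j+i (q * + m) (+ t)) (n<s[n/ℕd]*d x m))
  where
  x = + t + q * + m
  x<[1+q]m : x < (+ 1 + q) * + m
  x<[1+q]m = ℤP.<-≤-trans (ℤP.+-monoˡ-< (q * + m) (+<+ t<m))
               (ℤP.≤-reflexive (sym (trans (ℤP.*-distribʳ-+ (+ m) (+ 1) q)
                                           (cong (_+ q * + m) (ℤP.*-identityˡ (+ m))))))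

ceilDiv-unique : ∀ m .{{_ : NonZero m}} (t : ℕ) (q x : ℤ) → t ℕ.< m → x + + t ≡ q * + m →
                 ceilDiv x m ≡ q
ceilDiv-unique m t q x t<m x+t≡qm = begin
  - ((- x) /ℕ m)               ≡⟨ cong (λ y → - (y /ℕ m)) -x≡ ⟩
  - ((+ t + (- q) * + m) /ℕ m) ≡⟨ cong -_ (/ℕ-unique m t (- q) t<m) ⟩
  - - q                        ≡⟨ ℤP.neg-involutive q ⟩
  q                            ∎
  where
  negate : ∀ u v → - v ≡ u - (v + u)
  negate = solve-∀
  -x≡ : - x ≡ + t + (- q) * + m
  -x≡ = begin
    - x                ≡⟨ negate (+ t) x ⟩
    + t - (x + + t)    ≡⟨ cong (λ y → + t - y) x+t≡qm ⟩
    + t - q * + m      ≡⟨ cong (_+_ (+ t)) (ℤP.neg-distribˡ-* q (+ m)) ⟩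
    + t + (- q) * + m  ∎

ceilDiv-below : ∀ m .{{_ : NonZero m}} (q : ℤ) {r i : ℕ} → r ℕ.≤ m → i ℕ.< r →
                ceilDiv (+ r + q * + m - + i) m ≡ q + + 1
ceilDiv-below m q {r} {i} r≤m i<r =
  ceilDiv-unique m ((m ∸ r) ℕ.+ i) (q + + 1) (+ r + q * + m - + i) t<m (begin
    (+ r + q * + m - + i) + (+ (m ∸ r) + + i)   ≡⟨ cong (λ y → (+ r + q * + m - + i) + (y + + i))
                                                        (pos-∸ r≤m) ⟩
    (+ r + q * + m - + i) + ((+ m - + r) + + i) ≡⟨ regroup (+ r) q (+ m) (+ i) ⟩
    (q + + 1) * + m                             ∎)
  where
  t<m : (m ∸ r) ℕ.+ i ℕ.< m
  t<m = ℕP.<-≤-trans (ℕP.+-monoʳ-< (m ∸ r) i<r) (ℕP.≤-reflexive (ℕP.m∸n+n≡m r≤m))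
  regroup : ∀ r q m i → (r + q * m - i) + ((m - r) + i) ≡ (q + + 1) * m
  regroup = solve-∀

ceilDiv-above : ∀ m .{{_ : NonZero m}} (q : ℤ) {r i : ℕ} → r ℕ.≤ i → i ℕ.< m →
                ceilDiv (+ r + q * + m - + i) m ≡ q
ceilDiv-above m q {r} {i} r≤i i<m =
  ceilDiv-unique m (i ∸ r) q (+ r + q * + m - + i) (ℕP.≤-<-trans (ℕP.m∸n≤m i r) i<m) (begin
    (+ r + q * + m - + i) + + (i ∸ r)   ≡⟨ cong (_+_ (+ r + q * + m - + i)) (pos-∸ r≤i) ⟩
    (+ r + q * + m - + i) + (+ i - + r) ≡⟨ regroup (+ r) q (+ m) (+ i) ⟩
    q * + m                             ∎)
  where
  regroup : ∀ r q m i → (r + q * m - i) + (i - r) ≡ q * m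
  regroup = solve-∀

sumTo-ceilDiv : ∀ m .{{_ : NonZero m}} (q : ℤ) (r : ℕ) → r ℕ.≤ m → ∀ k → k ℕ.≤ m →
                sumTo k (λ i → ceilDiv (+ r + q * + m - + i) m) ≡ + k * q + + (r ⊓ k)
sumTo-ceilDiv m q r r≤m zero    _   = cong +_ (sym (ℕP.⊓-zeroʳ r))
sumTo-ceilDiv m q r r≤m (suc k) k<m with k ℕ.<? r
... | yes k<r = begin
  sumTo k f + f k                    ≡⟨ cong₂ _+_ (sumTo-ceilDiv m q r r≤m k (ℕP.<⇒≤ k<m))
                                                  (ceilDiv-below m q r≤m k<r) ⟩
  (+ k * q + + (r ⊓ k)) + (q + + 1)  ≡⟨ cong (λ z → (+ k * q + + z) + (q + + 1))
                                             (ℕP.m≥n⇒m⊓n≡n (ℕP.<⇒≤ k<r)) ⟩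
  (+ k * q + + k) + (q + + 1)        ≡⟨ step (+ k) q ⟩
  + suc k * q + + suc k              ≡⟨ cong (λ z → + suc k * q + + z) (sym (ℕP.m≥n⇒m⊓n≡n k<r)) ⟩
  + suc k * q + + (r ⊓ suc k)        ∎
  where
  f = λ i → ceilDiv (+ r + q * + m - + i) m
  step : ∀ k q → (k * q + k) + (q + + 1) ≡ (+ 1 + k) * q + (+ 1 + k)
  step = solve-∀
... | no k≮r = begin
  sumTo k f + f k                    ≡⟨ cong₂ _+_ (sumTo-ceilDiv m q r r≤m k (ℕP.<⇒≤ k<m))
                                                  (ceilDiv-above m q r≤k k<m) ⟩
  (+ k * q + + (r ⊓ k)) + q          ≡⟨ cong (λ z → (+ k * q + + z) + q) (ℕP.m≤n⇒m⊓n≡m r≤k) ⟩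
  (+ k * q + + r) + q                ≡⟨ step (+ k) q (+ r) ⟩
  + suc k * q + + r                  ≡⟨ cong (λ z → + suc k * q + + z)
                                             (sym (ℕP.m≤n⇒m⊓n≡m (ℕP.m≤n⇒m≤1+n r≤k))) ⟩
  + suc k * q + + (r ⊓ suc k)        ∎
  where
  f = λ i → ceilDiv (+ r + q * + m - + i) m
  r≤k = ℕP.≮⇒≥ k≮r
  step : ∀ k q r → (k * q + r) + q ≡ (+ 1 + k) * q + r
  step = solve-∀

balanced⇔ : ∀ d a₁ s₁ β₁ a₂ s₂ β₂ → a₁ + d ≡ β₁ * (+ 2 * d) → a₂ + d ≡ β₂ * (+ 2 * d) →
            ((a₁ - s₁ - β₁ * d) + (a₂ - s₂ - β₂ * d) + d ≡ + 0) ⇔ (+ 2 * (s₁ + s₂) ≡ a₁ + a₂)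
balanced⇔ d a₁ s₁ β₁ a₂ s₂ β₂ e₁ e₂ = mk⇔
  (λ K≡0 → sym (ℤP.i-j≡0⇒i≡j (a₁ + a₂) (+ 2 * (s₁ + s₂))
                                (trans (sym twiceK) (cong (+ 2 *_) K≡0))))
  (λ sum → ℤP.*-cancelˡ-≡ (+ 2) K (+ 0) (trans twiceK (ℤP.i≡j⇒i-j≡0 (sym sum))))
  where
  K = (a₁ - s₁ - β₁ * d) + (a₂ - s₂ - β₂ * d) + d
  twiceK : + 2 * K ≡ (a₁ + a₂) - + 2 * (s₁ + s₂)
  twiceK = begin
    + 2 * ((a₁ - s₁ - β₁ * d) + (a₂ - s₂ - β₂ * d) + d)
      ≡⟨ solve (d ∷ a₁ ∷ s₁ ∷ β₁ ∷ a₂ ∷ s₂ ∷ β₂ ∷ []) ⟩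
    + 2 * (a₁ + a₂) - + 2 * (s₁ + s₂) - (β₁ * (+ 2 * d) + β₂ * (+ 2 * d)) + + 2 * d
      ≡⟨ cong₂ (λ x y → + 2 * (a₁ + a₂) - + 2 * (s₁ + s₂) - (x + y) + + 2 * d)
               (sym e₁) (sym e₂) ⟩
    + 2 * (a₁ + a₂) - + 2 * (s₁ + s₂) - ((a₁ + d) + (a₂ + d)) + + 2 * d
      ≡⟨ solve (d ∷ a₁ ∷ s₁ ∷ a₂ ∷ s₂ ∷ []) ⟩
    (a₁ + a₂) - + 2 * (s₁ + s₂)
      ∎

module CProperties (k : ℕ) where

  j 2j : ℕ
  j = suc k
  2j = 2 ℕ.* j

  j+j≡2j : j ℕ.+ j ≡ 2j
  j+j≡2j = cong (j ℕ.+_) (sym (ℕP.+-identityʳ j))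

  j≤2j : j ℕ.≤ 2j
  j≤2j = ℕP.m≤m+n j (j ℕ.+ 0)

  2j∸j≡j : 2j ∸ j ≡ j
  2j∸j≡j = trans (cong (_∸ j) (sym j+j≡2j)) (ℕP.m+n∸m≡n j j)

  C-divMod : ∀ q r → r ℕ.≤ 2j → C j (+ r + q * + 2j) ≡ + j * q + + (r ⊓ j)
  C-divMod q r r≤2j = sumTo-ceilDiv 2j q r r≤2j j j≤2j

  C-at : ∀ n → C j n ≡ + j * (n /ℕ 2j) + + (n %ℕ 2j ⊓ j)
  C-at n = trans (cong (C j) (a≡a%ℕn+[a/ℕn]*n n 2j))
                 (C-divMod (n /ℕ 2j) (n %ℕ 2j) (ℕP.<⇒≤ (n%ℕd<d n 2j)))

  C-slope : ∀ q r → r ℕ.≤ j → C j (+ r + q * + 2j) ≡ + j * q + + r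
  C-slope q r r≤j = trans (C-divMod q r (ℕP.≤-trans r≤j j≤2j))
                          (cong (λ z → + j * q + + z) (ℕP.m≤n⇒m⊓n≡m r≤j))

  C-plateau : ∀ q r → j ℕ.≤ r → r ℕ.≤ 2j → C j (+ r + q * + 2j) ≡ + j * q + + j
  C-plateau q r j≤r r≤2j = trans (C-divMod q r r≤2j)
                                 (cong (λ z → + j * q + + z) (ℕP.m≥n⇒m⊓n≡n j≤r))

  C-+-multiple : ∀ n z → C j (n + z * + 2j) ≡ C j n + z * + j
  C-+-multiple n z = begin
    C j (n + z * + 2j)                 ≡⟨ cong (λ x → C j (x + z * + 2j)) (a≡a%ℕn+[a/ℕn]*n n 2j) ⟩
    C j ((+ r + q * + 2j) + z * + 2j)  ≡⟨ cong (C j) (regroup (+ r) q z (+ 2j)) ⟩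
    C j (+ r + (q + z) * + 2j)         ≡⟨ C-divMod (q + z) r (ℕP.<⇒≤ (n%ℕd<d n 2j)) ⟩
    + j * (q + z) + + (r ⊓ j)          ≡⟨ distribute (+ j) q z (+ (r ⊓ j)) ⟩
    (+ j * q + + (r ⊓ j)) + z * + j    ≡⟨ cong (_+ z * + j) (sym (C-at n)) ⟩
    C j n + z * + j                    ∎
    where
    q = n /ℕ 2j
    r = n %ℕ 2j
    regroup : ∀ r q z m → (r + q * m) + z * m ≡ r + (q + z) * m
    regroup = solve-∀
    distribute : ∀ d q z x → d * (q + z) + x ≡ (d * q + x) + z * d
    distribute = solve-∀

  C-+-period : ∀ n → C j (n + + 2j) ≡ C j n + + j
  C-+-period n = begin
    C j (n + + 2j)         ≡⟨ cong (λ x → C j (n + x)) (sym (ℤP.*-identityˡ (+ 2j))) ⟩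
    C j (n + + 1 * + 2j)   ≡⟨ C-+-multiple n (+ 1) ⟩
    C j n + + 1 * + j      ≡⟨ cong (_+_ (C j n)) (ℤP.*-identityˡ (+ j)) ⟩
    C j n + + j            ∎

  C-complement : ∀ n → C j n + C j (n - + j) ≡ n
  C-complement n with n %ℕ 2j ℕ.≤? j
  ... | yes r≤j = begin
    C j n + C j (n - + j)
      ≡⟨ cong₂ (λ x y → C j x + C j y) n≡ (trans (cong (_- + j) n≡) (lower (+ r) q (+ j))) ⟩
    C j (+ r + q * + 2j) + C j (+ (r ℕ.+ j) + (q - + 1) * + 2j)
      ≡⟨ cong₂ _+_ (C-slope q r r≤j) (C-plateau (q - + 1) (r ℕ.+ j) (ℕP.m≤n+m j r) r+j≤2j) ⟩
    (+ j * q + + r) + (+ j * (q - + 1) + + j)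
      ≡⟨ collect (+ r) q (+ j) ⟩
    + r + q * + 2j
      ≡⟨ sym n≡ ⟩
    n ∎
    where
    q = n /ℕ 2j
    r = n %ℕ 2j
    n≡ = a≡a%ℕn+[a/ℕn]*n n 2j
    r+j≤2j : r ℕ.+ j ℕ.≤ 2j
    r+j≤2j = subst (r ℕ.+ j ℕ.≤_) j+j≡2j (ℕP.+-monoˡ-≤ j r≤j)
    lower : ∀ r q d → (r + q * (+ 2 * d)) - d ≡ (r + d) + (q - + 1) * (+ 2 * d)
    lower = solve-∀
    collect : ∀ r q d → (d * q + r) + (d * (q - + 1) + d) ≡ r + q * (+ 2 * d)
    collect = solve-∀
  ... | no r≰j = begin
    C j n + C j (n - + j)
      ≡⟨ cong₂ (λ x y → C j x + C j y) n≡ (trans (cong (_- + j) n≡) (lower (+ r) q (+ j))) ⟩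
    C j (+ r + q * + 2j) + C j ((+ r - + j) + q * + 2j)
      ≡⟨ cong (λ x → C j (+ r + q * + 2j) + C j (x + q * + 2j)) (sym (pos-∸ j≤r)) ⟩
    C j (+ r + q * + 2j) + C j (+ (r ∸ j) + q * + 2j)
      ≡⟨ cong₂ _+_ (C-plateau q r j≤r r≤2j) (C-slope q (r ∸ j) r∸j≤j) ⟩
    (+ j * q + + j) + (+ j * q + + (r ∸ j))
      ≡⟨ cong (λ x → (+ j * q + + j) + (+ j * q + x)) (pos-∸ j≤r) ⟩
    (+ j * q + + j) + (+ j * q + (+ r - + j))
      ≡⟨ collect (+ r) q (+ j) ⟩
    + r + q * + 2j
      ≡⟨ sym n≡ ⟩
    n ∎
    where
    q = n /ℕ 2j
    r = n %ℕ 2j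
    n≡ = a≡a%ℕn+[a/ℕn]*n n 2j
    j≤r = ℕP.<⇒≤ (ℕP.≰⇒> r≰j)
    r≤2j = ℕP.<⇒≤ (n%ℕd<d n 2j)
    r∸j≤j : r ∸ j ℕ.≤ j
    r∸j≤j = ℕP.m≤n+o⇒m∸n≤o r j (subst (r ℕ.≤_) (sym j+j≡2j) r≤2j)
    lower : ∀ r q d → (r + q * (+ 2 * d)) - d ≡ (r - d) + q * (+ 2 * d)
    lower = solve-∀
    collect : ∀ r q d → (d * q + d) + (d * q + (r - d)) ≡ r + q * (+ 2 * d)
    collect = solve-∀

  C-complement-+ : ∀ n → C j (n + + j) + C j n ≡ n + + j
  C-complement-+ n = begin
    C j (n + + j) + C j n                ≡⟨ cong (λ x → C j (n + + j) + C j x) (cancel n (+ j)) ⟩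
    C j (n + + j) + C j (n + + j - + j)  ≡⟨ C-complement (n + + j) ⟩
    n + + j                              ∎
    where
    cancel : ∀ n d → n ≡ n + d - d
    cancel = solve-∀

  C-identity : ∀ r → r ℕ.≤ j → C j (+ r) ≡ + r
  C-identity r r≤j = begin
    C j (+ r)                ≡⟨ cong (C j) (sym (ℤP.+-identityʳ (+ r))) ⟩
    C j (+ r + + 0 * + 2j)   ≡⟨ C-slope (+ 0) r r≤j ⟩
    + j * + 0 + + r          ≡⟨ cong (_+ + r) (ℤP.*-zeroʳ (+ j)) ⟩
    + r                      ∎

  C-constant : ∀ r → j ℕ.≤ r → r ℕ.≤ 2j → C j (+ r) ≡ + j
  C-constant r j≤r r≤2j = begin
    C j (+ r)                ≡⟨ cong (C j) (sym (ℤP.+-identityʳ (+ r))) ⟩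
    C j (+ r + + 0 * + 2j)   ≡⟨ C-plateau (+ 0) r j≤r r≤2j ⟩
    + j * + 0 + + j          ≡⟨ cong (_+ + j) (ℤP.*-zeroʳ (+ j)) ⟩
    + j                      ∎

  C-vanishes : ∀ r → r ℕ.≤ j → C j (- + r) ≡ + 0
  C-vanishes r r≤j = begin
    C j (- + r)                          ≡⟨ cong (C j) (wrap (+ r) (+ 2j)) ⟩
    C j ((+ 2j - + r) + - + 1 * + 2j)    ≡⟨ cong (λ x → C j (x + - + 1 * + 2j)) (sym (pos-∸ r≤2j)) ⟩
    C j (+ (2j ∸ r) + - + 1 * + 2j)      ≡⟨ C-plateau (- + 1) (2j ∸ r) j≤2j∸r (ℕP.m∸n≤m 2j r) ⟩
    + j * - + 1 + + j                    ≡⟨ cancel (+ j) ⟩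
    + 0                                  ∎
    where
    r≤2j = ℕP.≤-trans r≤j j≤2j
    j≤2j∸r : j ℕ.≤ 2j ∸ r
    j≤2j∸r = subst (ℕ._≤ 2j ∸ r) 2j∸j≡j (ℕP.∸-monoʳ-≤ 2j r≤j)
    wrap : ∀ r m → - r ≡ (m - r) + - + 1 * m
    wrap = solve-∀
    cancel : ∀ d → d * - + 1 + d ≡ + 0
    cancel = solve-∀

  C-rise : ∀ B → B ℕ.< 2j →
           Σ ℕ λ p → C j (+ 2j - + B) ≡ C j (+ j - + B) + + p × (p ≡ 0 → B ≡ 0)
  C-rise B B<2j with B ℕ.≤? j
  ... | yes B≤j = B , (begin
    C j (+ 2j - + B)        ≡⟨ cong (C j) (sym (pos-∸ (ℕP.<⇒≤ B<2j))) ⟩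
    C j (+ (2j ∸ B))        ≡⟨ C-constant (2j ∸ B) j≤2j∸B (ℕP.m∸n≤m 2j B) ⟩
    + j                     ≡⟨ cong +_ (sym (ℕP.m∸n+n≡m B≤j)) ⟩
    + (j ∸ B) + + B         ≡⟨ cong (_+ + B) (sym (C-identity (j ∸ B) (ℕP.m∸n≤m j B))) ⟩
    C j (+ (j ∸ B)) + + B   ≡⟨ cong (λ x → C j x + + B) (pos-∸ B≤j) ⟩
    C j (+ j - + B) + + B   ∎) , λ B≡0 → B≡0
    where
    j≤2j∸B : j ℕ.≤ 2j ∸ B
    j≤2j∸B = subst (ℕ._≤ 2j ∸ B) 2j∸j≡j (ℕP.∸-monoʳ-≤ 2j B≤j)
  ... | no B≰j = 2j ∸ B , (begin
    C j (+ 2j - + B)                ≡⟨ cong (C j) (sym (pos-∸ (ℕP.<⇒≤ B<2j))) ⟩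
    C j (+ (2j ∸ B))                ≡⟨ C-identity (2j ∸ B) 2j∸B≤j ⟩
    + (2j ∸ B)                      ≡⟨ cong (_+ + (2j ∸ B)) (sym (C-vanishes (B ∸ j) B∸j≤j)) ⟩
    C j (- + (B ∸ j)) + + (2j ∸ B)  ≡⟨ cong (λ x → C j x + + (2j ∸ B)) (sym j-B≡) ⟩
    C j (+ j - + B) + + (2j ∸ B)    ∎) , λ p≡0 → ⊥-elim (ℕP.<⇒≢ (ℕP.m<n⇒0<n∸m B<2j) (sym p≡0))
    where
    j≤B = ℕP.<⇒≤ (ℕP.≰⇒> B≰j)
    2j∸B≤j : 2j ∸ B ℕ.≤ j
    2j∸B≤j = subst (2j ∸ B ℕ.≤_) 2j∸j≡j (ℕP.∸-monoʳ-≤ 2j j≤B)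
    B∸j≤j : B ∸ j ℕ.≤ j
    B∸j≤j = subst (B ∸ j ℕ.≤_) 2j∸j≡j (ℕP.∸-monoˡ-≤ j (ℕP.<⇒≤ B<2j))
    j-B≡ : + j - + B ≡ - + (B ∸ j)
    j-B≡ = trans (ℤP.[+m]-[+n]≡m⊖n j B) (ℤP.⊖-≤ j≤B)

  C-surjective : ∀ x → Σ ℤ λ n → C j n ≡ x
  C-surjective x = + ρ + γ * + 2j , (begin
    C j (+ ρ + γ * + 2j)  ≡⟨ C-slope γ ρ (ℕP.<⇒≤ (n%ℕd<d x j)) ⟩
    + j * γ + + ρ         ≡⟨ swap (+ j) γ (+ ρ) ⟩
    + ρ + γ * + j         ≡⟨ sym (a≡a%ℕn+[a/ℕn]*n x j) ⟩
    x                     ∎)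
    where
    ρ = x %ℕ j
    γ = x /ℕ j
    swap : ∀ d γ ρ → d * γ + ρ ≡ ρ + γ * d
    swap = solve-∀

  C[x+x]≡x⇒j∣x : ∀ x → C j (x + x) ≡ x → + j Signed.∣ x
  C[x+x]≡x⇒j∣x x fixed = Signed.divides γ (begin
    x              ≡⟨ x≡ ⟩
    + ρ + γ * + j  ≡⟨ cong (λ z → + z + γ * + j) ρ≡0 ⟩
    + 0 + γ * + j  ≡⟨ ℤP.+-identityˡ (γ * + j) ⟩
    γ * + j        ∎)
    where
    ρ = x %ℕ j
    γ = x /ℕ j
    x≡ = a≡a%ℕn+[a/ℕn]*n x j
    ρ<j = n%ℕd<d x j
    ρ+ρ≤2j : ρ ℕ.+ ρ ℕ.≤ 2j
    ρ+ρ≤2j = subst (ρ ℕ.+ ρ ℕ.≤_) j+j≡2j (ℕP.+-mono-≤ (ℕP.<⇒≤ ρ<j) (ℕP.<⇒≤ ρ<j))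
    double : ∀ ρ γ d → x ≡ ρ + γ * d → x + x ≡ (ρ + ρ) + γ * (+ 2 * d)
    double ρ γ d refl = solve (ρ ∷ γ ∷ d ∷ [])
    swap : ∀ d γ ρ → d * γ + ρ ≡ ρ + γ * d
    swap = solve-∀
    same-remainder : + j * γ + + ((ρ ℕ.+ ρ) ⊓ j) ≡ + j * γ + + ρ
    same-remainder = begin
      + j * γ + + ((ρ ℕ.+ ρ) ⊓ j)    ≡⟨ sym (C-divMod γ (ρ ℕ.+ ρ) ρ+ρ≤2j) ⟩
      C j (+ (ρ ℕ.+ ρ) + γ * + 2j)   ≡⟨ cong (C j) (sym (double (+ ρ) γ (+ j) x≡)) ⟩
      C j (x + x)                    ≡⟨ fixed ⟩
      x                              ≡⟨ x≡ ⟩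
      + ρ + γ * + j                  ≡⟨ sym (swap (+ j) γ (+ ρ)) ⟩
      + j * γ + + ρ                  ∎
    ρ≡0 : ρ ≡ 0
    ρ≡0 = [ρ+ρ]⊓m≡ρ⇒ρ≡0 ρ<j (ℤP.+-injective (∙-cancelˡ (+ j * γ) _ _ same-remainder))

  C-antidiagonal : ∀ x c₁ c₂ → + j Signed.∣ c₁ → c₁ + c₂ + + j ≡ + 0 →
                   C j (x + c₁) + C j (x + c₂) ≡ x
  C-antidiagonal x c₁ c₂ (Signed.divides κ c₁≡κj) balanced = begin
    C j (x + c₁) + C j y                ≡⟨ cong (λ z → C j z + C j y)
                                                (wind x c₁ c₂ κ (+ j) c₁≡κj balanced) ⟩
    C j ((y + + j) + κ * + 2j) + C j y  ≡⟨ cong (_+ C j y) (C-+-multiple (y + + j) κ) ⟩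
    (C j (y + + j) + κ * + j) + C j y   ≡⟨ swap (C j (y + + j)) (κ * + j) (C j y) ⟩
    (C j (y + + j) + C j y) + κ * + j   ≡⟨ cong (_+ κ * + j) (C-complement-+ y) ⟩
    (y + + j) + κ * + j                 ≡⟨ unwind x c₁ c₂ κ (+ j) c₁≡κj balanced ⟩
    x                                   ∎
    where
    y = x + c₂
    swap : ∀ a b c → (a + b) + c ≡ (a + c) + b
    swap = solve-∀
    wind : ∀ x c₁ c₂ κ d → c₁ ≡ κ * d → c₁ + c₂ + d ≡ + 0 →
           x + c₁ ≡ ((x + c₂) + d) + κ * (+ 2 * d)
    wind x .(κ * d) c₂ κ d refl e = begin
      x + κ * d                                          ≡⟨ solve (x ∷ c₂ ∷ κ ∷ d ∷ []) ⟩
      ((x + c₂) + d) + κ * (+ 2 * d) - (κ * d + c₂ + d)  ≡⟨ cong (_-_ (((x + c₂) + d) + κ * (+ 2 * d))) e ⟩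
      ((x + c₂) + d) + κ * (+ 2 * d) - + 0               ≡⟨ ℤP.+-identityʳ _ ⟩
      ((x + c₂) + d) + κ * (+ 2 * d)                     ∎
    unwind : ∀ x c₁ c₂ κ d → c₁ ≡ κ * d → c₁ + c₂ + d ≡ + 0 → ((x + c₂) + d) + κ * d ≡ x
    unwind x .(κ * d) c₂ κ d refl e = begin
      ((x + c₂) + d) + κ * d  ≡⟨ solve (x ∷ c₂ ∷ κ ∷ d ∷ []) ⟩
      x + (κ * d + c₂ + d)    ≡⟨ cong (_+_ x) e ⟩
      x + + 0                 ≡⟨ ℤP.+-identityʳ x ⟩
      x                       ∎

  inner : ℤ → ℤ → ℤ → ℤ
  inner s a n = n - s - C j (n - a)

  inner-+-period : ∀ s a n → inner s a (n + + 2j) ≡ inner s a n + + j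
  inner-+-period s a n = begin
    n + + 2j - s - C j (n + + 2j - a)    ≡⟨ cong (λ x → n + + 2j - s - C j x) (reorder n (+ 2j) a) ⟩
    n + + 2j - s - C j ((n - a) + + 2j)  ≡⟨ cong (λ x → n + + 2j - s - x) (C-+-period (n - a)) ⟩
    n + + 2j - s - (C j (n - a) + + j)   ≡⟨ collect n s (C j (n - a)) (+ j) ⟩
    (n - s - C j (n - a)) + + j          ∎
    where
    reorder : ∀ n m a → n + m - a ≡ (n - a) + m
    reorder = solve-∀
    collect : ∀ n s c d → n + + 2 * d - s - (c + d) ≡ (n - s - c) + d
    collect = solve-∀

  inner-reduce : ∀ s a B β n → a + + j ≡ + B + β * + 2j →
                 inner s a n ≡ C j (n - + B) + (a - s - β * + j)
  inner-reduce s a B β n a+j≡ = begin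
    n - s - C j (n - a)
      ≡⟨ cong (λ x → n - s - x) (C≡complement (n - a)) ⟩
    n - s - ((n - a) - C j (n - a - + j))
      ≡⟨ cong (λ x → n - s - ((n - a) - C j x)) n-a-j≡ ⟩
    n - s - ((n - a) - C j ((n - + B) + - β * + 2j))
      ≡⟨ cong (λ x → n - s - ((n - a) - x)) (C-+-multiple (n - + B) (- β)) ⟩
    n - s - ((n - a) - (C j (n - + B) + - β * + j))
      ≡⟨ collect n s a (C j (n - + B)) β (+ j) ⟩
    C j (n - + B) + (a - s - β * + j)
      ∎
    where
    solve-for : ∀ x y → x ≡ (x + y) - y
    solve-for = solve-∀
    C≡complement : ∀ m → C j m ≡ m - C j (m - + j)
    C≡complement m = trans (solve-for (C j m) (C j (m - + j))) (cong (_- C j (m - + j)) (C-complement m))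
    split : ∀ n a d → n - a - d ≡ n - (a + d)
    split = solve-∀
    spread : ∀ n b β m → n - (b + β * m) ≡ (n - b) + - β * m
    spread = solve-∀
    n-a-j≡ : n - a - + j ≡ (n - + B) + - β * + 2j
    n-a-j≡ = begin
      n - a - + j              ≡⟨ split n a (+ j) ⟩
      n - (a + + j)            ≡⟨ cong (_-_ n) a+j≡ ⟩
      n - (+ B + β * + 2j)     ≡⟨ spread n (+ B) β (+ 2j) ⟩
      (n - + B) + - β * + 2j   ∎
    collect : ∀ n s a c β d → n - s - ((n - a) - (c + - β * d)) ≡ c + (a - s - β * d)
    collect = solve-∀

  inner-aligned : ∀ s a β n → a + + j ≡ β * + 2j → inner s a n ≡ C j n + (a - s - β * + j)
  inner-aligned s a β n a+j≡ = begin
    inner s a n                        ≡⟨ inner-reduce s a 0 β n (trans a+j≡ (sym (ℤP.+-identityˡ _))) ⟩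
    C j (n - + 0) + (a - s - β * + j)  ≡⟨ cong (λ x → C j x + (a - s - β * + j)) (ℤP.+-identityʳ n) ⟩
    C j n + (a - s - β * + j)          ∎

  2j∣a-j⇔2j∣a+j : ∀ a → (+ 2j Signed.∣ a - + j) ⇔ (+ 2j Signed.∣ a + + j)
  2j∣a-j⇔2j∣a+j a = mk⇔
    (λ 2j∣a-j → subst (+ 2j Signed.∣_) (shift a (+ j)) (Signed.∣m∣n⇒∣m+n 2j∣a-j Signed.∣-refl))
    (λ 2j∣a+j → Signed.∣m+n∣n⇒∣m (subst (+ 2j Signed.∣_) (sym (shift a (+ j))) 2j∣a+j) Signed.∣-refl)
    where
    shift : ∀ a d → (a - d) + + 2 * d ≡ a + d
    shift = solve-∀

  j∣s⇔j∣residue : ∀ s a β → a + + j ≡ β * + 2j →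
                  (+ j Signed.∣ s) ⇔ (+ j Signed.∣ a - s - β * + j)
  j∣s⇔j∣residue s a β a+j≡ = mk⇔
    (λ j∣s → Signed.∣m∣n⇒∣m-n (Signed.∣m∣n⇒∣m-n j∣a j∣s) j∣βj)
    (λ j∣r → subst (+ j Signed.∣_) (ℤP.neg-involutive s)
               (Signed.∣m⇒∣-m (Signed.∣m+n∣m⇒∣n (j∣a-s j∣r) j∣a)))
    where
    j∣βj : + j Signed.∣ β * + j
    j∣βj = Signed.∣n⇒∣m*n β Signed.∣-refl
    j∣a-s : + j Signed.∣ a - s - β * + j → + j Signed.∣ a - s
    j∣a-s j∣r = Signed.∣m+n∣n⇒∣m j∣r (Signed.∣m⇒∣-m j∣βj)
    j∣a : + j Signed.∣ a
    j∣a = Signed.∣m+n∣n⇒∣m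
            (subst (+ j Signed.∣_) (sym a+j≡) (Signed.∣n⇒∣m*n β (Signed.∣n⇒∣m*n (+ 2) Signed.∣-refl)))
            Signed.∣-refl

module Sufficiency (k : ℕ) where
  open CProperties k

  satisfies : ∀ s₁ a₁ s₂ a₂ →
              (+ j ∣ s₁ × + j ∣ s₂) × (+ 2 * + j ∣ a₁ - + j × + 2 * + j ∣ a₂ - + j)
                × + 2 * (s₁ + s₂) ≡ a₁ + a₂ →
              SatisfiesRec (C j) s₁ a₁ s₂ a₂
  satisfies s₁ a₁ s₂ a₂ ((j∣s₁ , _) , (2j∣a₁-j , 2j∣a₂-j) , sum) n = begin
    C j n
      ≡⟨ sym (C-antidiagonal (C j n) c₁ c₂ j∣c₁ balanced) ⟩
    C j (C j n + c₁) + C j (C j n + c₂)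
      ≡⟨ sym (cong₂ (λ x y → C j x + C j y) (inner-aligned s₁ a₁ β₁ n a₁+j≡)
                                            (inner-aligned s₂ a₂ β₂ n a₂+j≡)) ⟩
    C j (inner s₁ a₁ n) + C j (inner s₂ a₂ n)
      ∎
    where
    2j∣a₁+j = Equivalence.to (2j∣a-j⇔2j∣a+j a₁) (Signed.∣ᵤ⇒∣ 2j∣a₁-j)
    2j∣a₂+j = Equivalence.to (2j∣a-j⇔2j∣a+j a₂) (Signed.∣ᵤ⇒∣ 2j∣a₂-j)
    β₁ = Signed.quotient 2j∣a₁+j
    β₂ = Signed.quotient 2j∣a₂+j
    a₁+j≡ = Signed._∣_.equality 2j∣a₁+j
    a₂+j≡ = Signed._∣_.equality 2j∣a₂+j
    c₁ = a₁ - s₁ - β₁ * + j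
    c₂ = a₂ - s₂ - β₂ * + j
    j∣c₁ = Equivalence.to (j∣s⇔j∣residue s₁ a₁ β₁ a₁+j≡) (Signed.∣ᵤ⇒∣ j∣s₁)
    balanced = Equivalence.from (balanced⇔ (+ j) a₁ s₁ β₁ a₂ s₂ β₂ a₁+j≡ a₂+j≡) sum

module Necessity (k : ℕ) (s₁ a₁ s₂ a₂ : ℤ) (rec : SatisfiesRec (C (suc k)) s₁ a₁ s₂ a₂) where
  open CProperties k

  twice-C : ∀ n → C j n + C j n ≡ inner s₁ a₁ n + inner s₂ a₂ n + + j
  twice-C n = ∙-cancelʳ (+ j) _ _ (begin
    (C j n + C j n) + + j
      ≡⟨ ℤP.+-assoc (C j n) (C j n) (+ j) ⟩
    C j n + (C j n + + j)
      ≡⟨ cong₂ _+_ (rec n) shifted ⟩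
    (C j u₁ + C j u₂) + (C j (u₁ + + j) + C j (u₂ + + j))
      ≡⟨ interchange (C j u₁) (C j u₂) (C j (u₁ + + j)) (C j (u₂ + + j)) ⟩
    (C j (u₁ + + j) + C j u₁) + (C j (u₂ + + j) + C j u₂)
      ≡⟨ cong₂ _+_ (C-complement-+ u₁) (C-complement-+ u₂) ⟩
    (u₁ + + j) + (u₂ + + j)
      ≡⟨ regroup u₁ u₂ (+ j) ⟩
    (u₁ + u₂ + + j) + + j
      ∎)
    where
    u₁ = inner s₁ a₁ n
    u₂ = inner s₂ a₂ n
    shifted : C j n + + j ≡ C j (u₁ + + j) + C j (u₂ + + j)
    shifted = begin
      C j n + + j
        ≡⟨ sym (C-+-period n) ⟩
      C j (n + + 2j)
        ≡⟨ rec (n + + 2j) ⟩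
      C j (inner s₁ a₁ (n + + 2j)) + C j (inner s₂ a₂ (n + + 2j))
        ≡⟨ cong₂ (λ x y → C j x + C j y) (inner-+-period s₁ a₁ n) (inner-+-period s₂ a₂ n) ⟩
      C j (u₁ + + j) + C j (u₂ + + j)
        ∎
    interchange : ∀ x y z w → (x + y) + (z + w) ≡ (z + x) + (w + y)
    interchange = solve-∀
    regroup : ∀ x y d → (x + d) + (y + d) ≡ (x + y + d) + d
    regroup = solve-∀

  B₁ B₂ : ℕ
  B₁ = (a₁ + + j) %ℕ 2j
  B₂ = (a₂ + + j) %ℕ 2j

  β₁ β₂ c₁ c₂ : ℤ
  β₁ = (a₁ + + j) /ℕ 2j
  β₂ = (a₂ + + j) /ℕ 2j
  c₁ = a₁ - s₁ - β₁ * + j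
  c₂ = a₂ - s₂ - β₂ * + j

  twice-C-reduced : ∀ n → C j n + C j n ≡ (C j (n - + B₁) + C j (n - + B₂)) + (c₁ + c₂ + + j)
  twice-C-reduced n = begin
    C j n + C j n
      ≡⟨ twice-C n ⟩
    inner s₁ a₁ n + inner s₂ a₂ n + + j
      ≡⟨ cong₂ (λ x y → x + y + + j)
               (inner-reduce s₁ a₁ B₁ β₁ n (a≡a%ℕn+[a/ℕn]*n (a₁ + + j) 2j))
               (inner-reduce s₂ a₂ B₂ β₂ n (a≡a%ℕn+[a/ℕn]*n (a₂ + + j) 2j)) ⟩
    (C j (n - + B₁) + c₁) + (C j (n - + B₂) + c₂) + + j
      ≡⟨ regroup (C j (n - + B₁)) c₁ (C j (n - + B₂)) c₂ (+ j) ⟩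
    (C j (n - + B₁) + C j (n - + B₂)) + (c₁ + c₂ + + j)
      ∎
    where
    regroup : ∀ x c₁ y c₂ d → (x + c₁) + (y + c₂) + d ≡ (x + y) + (c₁ + c₂ + d)
    regroup = solve-∀

  rises-agree : C j (+ 2j - + B₁) + C j (+ 2j - + B₂) ≡ C j (+ j - + B₁) + C j (+ j - + B₂)
  rises-agree = ∙-cancelʳ (c₁ + c₂ + + j) _ _ (begin
    (C j (+ 2j - + B₁) + C j (+ 2j - + B₂)) + (c₁ + c₂ + + j)  ≡⟨ sym (twice-C-reduced (+ 2j)) ⟩
    C j (+ 2j) + C j (+ 2j)                                    ≡⟨ cong₂ _+_ C[2j]≡j C[2j]≡j ⟩
    + j + + j                                                  ≡⟨ sym (cong₂ _+_ C[j]≡j C[j]≡j) ⟩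
    C j (+ j) + C j (+ j)                                      ≡⟨ twice-C-reduced (+ j) ⟩
    (C j (+ j - + B₁) + C j (+ j - + B₂)) + (c₁ + c₂ + + j)    ∎)
    where
    C[2j]≡j = C-constant 2j j≤2j ℕP.≤-refl
    C[j]≡j = C-identity j ℕP.≤-refl

  B₁≡0×B₂≡0 : B₁ ≡ 0 × B₂ ≡ 0
  B₁≡0×B₂≡0 = proj₂ (proj₂ rise₁) (ℕP.m+n≡0⇒m≡0 p₁ p₁+p₂≡0)
            , proj₂ (proj₂ rise₂) (ℕP.m+n≡0⇒n≡0 p₁ p₁+p₂≡0)
    where
    rise₁ = C-rise B₁ (n%ℕd<d (a₁ + + j) 2j)
    rise₂ = C-rise B₂ (n%ℕd<d (a₂ + + j) 2j)
    p₁ = proj₁ rise₁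
    p₂ = proj₁ rise₂
    excess : ∀ x y u v → (x + u) + (y + v) ≡ x + y → u + v ≡ + 0
    excess x y u v h = begin
      u + v                          ≡⟨ solve (x ∷ y ∷ u ∷ v ∷ []) ⟩
      ((x + u) + (y + v)) - (x + y)  ≡⟨ cong (_- (x + y)) h ⟩
      (x + y) - (x + y)              ≡⟨ ℤP.+-inverseʳ (x + y) ⟩
      + 0                            ∎
    p₁+p₂≡0 : p₁ ℕ.+ p₂ ≡ 0
    p₁+p₂≡0 = ℤP.+-injective (excess (C j (+ j - + B₁)) (C j (+ j - + B₂)) (+ p₁) (+ p₂)
                (trans (sym (cong₂ _+_ (proj₁ (proj₂ rise₁)) (proj₁ (proj₂ rise₂)))) rises-agree))

  a₁+j≡ : a₁ + + j ≡ β₁ * + 2j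
  a₁+j≡ = %ℕ≡0⇒≡/ℕ* (a₁ + + j) 2j (proj₁ B₁≡0×B₂≡0)

  a₂+j≡ : a₂ + + j ≡ β₂ * + 2j
  a₂+j≡ = %ℕ≡0⇒≡/ℕ* (a₂ + + j) 2j (proj₂ B₁≡0×B₂≡0)

  balanced : c₁ + c₂ + + j ≡ + 0
  balanced = excess (C j (+ 0)) c₁ c₂ (+ j) (begin
    C j (+ 0) + C j (+ 0)                        ≡⟨ twice-C (+ 0) ⟩
    inner s₁ a₁ (+ 0) + inner s₂ a₂ (+ 0) + + j  ≡⟨ cong₂ (λ x y → x + y + + j)
                                                         (inner-aligned s₁ a₁ β₁ (+ 0) a₁+j≡)
                                                         (inner-aligned s₂ a₂ β₂ (+ 0) a₂+j≡) ⟩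
    (C j (+ 0) + c₁) + (C j (+ 0) + c₂) + + j    ∎)
    where
    excess : ∀ x c₁ c₂ d → x + x ≡ (x + c₁) + (x + c₂) + d → c₁ + c₂ + d ≡ + 0
    excess x c₁ c₂ d h = begin
      c₁ + c₂ + d                          ≡⟨ solve (x ∷ c₁ ∷ c₂ ∷ d ∷ []) ⟩
      ((x + c₁) + (x + c₂) + d) - (x + x)  ≡⟨ cong (_- (x + x)) (sym h) ⟩
      (x + x) - (x + x)                    ≡⟨ ℤP.+-inverseʳ (x + x) ⟩
      + 0                                  ∎

  C[c₁+c₁]≡c₁ : C j (c₁ + c₁) ≡ c₁
  C[c₁+c₁]≡c₁ = begin
    C j (c₁ + c₁)                                ≡⟨ sym (ℤP.+-identityʳ _) ⟩
    C j (c₁ + c₁) + + 0                          ≡⟨ cong (_+_ (C j (c₁ + c₁))) (sym C[c₁+c₂]≡0) ⟩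
    C j (c₁ + c₁) + C j (c₁ + c₂)                ≡⟨ cong (λ x → C j (x + c₁) + C j (x + c₂))
                                                         (sym Cn₀≡c₁) ⟩
    C j (C j n₀ + c₁) + C j (C j n₀ + c₂)        ≡⟨ cong₂ (λ x y → C j x + C j y)
                                                          (sym (inner-aligned s₁ a₁ β₁ n₀ a₁+j≡))
                                                          (sym (inner-aligned s₂ a₂ β₂ n₀ a₂+j≡)) ⟩
    C j (inner s₁ a₁ n₀) + C j (inner s₂ a₂ n₀)  ≡⟨ sym (rec n₀) ⟩
    C j n₀                                       ≡⟨ Cn₀≡c₁ ⟩
    c₁                                           ∎
    where
    n₀ = proj₁ (C-surjective c₁)
    Cn₀≡c₁ = proj₂ (C-surjective c₁)
    c₁+c₂≡-j : c₁ + c₂ ≡ - + j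
    c₁+c₂≡-j = ∙-cancelʳ (+ j) (c₁ + c₂) (- + j) (trans balanced (sym (ℤP.+-inverseˡ (+ j))))
    C[c₁+c₂]≡0 : C j (c₁ + c₂) ≡ + 0
    C[c₁+c₂]≡0 = trans (cong (C j) c₁+c₂≡-j) (C-vanishes j ℕP.≤-refl)

  j∣c₁ : + j Signed.∣ c₁
  j∣c₁ = C[x+x]≡x⇒j∣x c₁ C[c₁+c₁]≡c₁

  j∣c₂ : + j Signed.∣ c₂
  j∣c₂ = Signed.∣m+n∣m⇒∣n j∣c₁+c₂ j∣c₁
    where
    j∣c₁+c₂ : + j Signed.∣ c₁ + c₂
    j∣c₁+c₂ = Signed.∣m+n∣n⇒∣m (Signed.divides (+ 0) balanced) Signed.∣-refl

  conditions : (+ j ∣ s₁ × + j ∣ s₂) × (+ 2 * + j ∣ a₁ - + j × + 2 * + j ∣ a₂ - + j)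
               × + 2 * (s₁ + s₂) ≡ a₁ + a₂
  conditions =
    ( Signed.∣⇒∣ᵤ (Equivalence.from (j∣s⇔j∣residue s₁ a₁ β₁ a₁+j≡) j∣c₁)
    , Signed.∣⇒∣ᵤ (Equivalence.from (j∣s⇔j∣residue s₂ a₂ β₂ a₂+j≡) j∣c₂) )
    , ( Signed.∣⇒∣ᵤ (Equivalence.from (2j∣a-j⇔2j∣a+j a₁) (Signed.divides β₁ a₁+j≡))
      , Signed.∣⇒∣ᵤ (Equivalence.from (2j∣a-j⇔2j∣a+j a₂) (Signed.divides β₂ a₂+j≡)) )
    , Equivalence.to (balanced⇔ (+ j) a₁ s₁ β₁ a₂ s₂ β₂ a₁+j≡ a₂+j≡) balanced

mainTheorem1 : (j : ℕ) → .{{_ : NonZero j}} → (s₁ a₁ s₂ a₂ : ℤ) →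
    SatisfiesRec (C j) s₁ a₁ s₂ a₂
      ⇔ ((+ j ∣ s₁ × + j ∣ s₂)
         × (+ 2 * + j ∣ a₁ - + j × + 2 * + j ∣ a₂ - + j)
         × + 2 * (s₁ + s₂) ≡ a₁ + a₂)
mainTheorem1 (suc k) s₁ a₁ s₂ a₂ =
  mk⇔ (Necessity.conditions k s₁ a₁ s₂ a₂) (Sufficiency.satisfies k s₁ a₁ s₂ a₂)
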